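{- Let $T$ be a circle-tree which is determined by the sequence of circles $(C(i):i<k)$. For any $j<k$ there is a sequence of circles $(C'(i):i<k)$ which also determines $T$ and satisfies $C'(0)=C(j)$.
   Context: All graphs are finite simple graphs. A circle is a finite connected graph in which every vertex has degree exactly $2$. For disjoint graphs $G,H$ with $\Delta(G),\Delta(H)\le3$ and vertices $x\in G$, $y\in H$ of degree $2$ in their respective graphs, $G+_{x,y}H$ is the disjoint union of $G$ and $H$ with the single extra edge $\{x,y\}$. A finite graph $T$ is a circle-tree determined by circles $(C(i):i<k)$ if $T(0)=C(0)$, for each $0<i<k$ the circle $C(i)$ is disjoint from $T(i-1)$ and $T(i)=T(i-1)+_{x,y}C(i)$ for some $x\in T(i-1)$ of degree $2$ in $T(i-1)$ and $y\in C(i)$, and $T=T(k-1)$. -}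

module Defs where

open import Data.Nat using (ℕ; zero; suc; _≤_)
open import Data.Bool using (Bool; true; false; _∨_; _∧_)
open import Data.List using (List; []; length; filterᵇ; _++_)
open import Data.List.Membership.Propositional using (_∈_)
open import Data.List.Relation.Unary.Unique.Propositional using (Unique)
open import Data.Fin using (Fin; zero; suc; inject₁; fromℕ)
open import Data.Product using (Σ; _×_; _,_; ∃)
open import Data.Sum using (_⊎_)
open import Data.Empty using (⊥)
open import Relation.Nullary using (¬_)
open import Relation.Binary.PropositionalEquality using (_≡_; _≢_)
open import Function.Bundles using (_⇔_)

record Graph : Set where
  field
    verts  : List ℕ
    uniq   : Unique verts
    adj    : ℕ → ℕ → Bool
    adjSym : ∀ u v → adj u v ≡ adj v u
    irrefl : ∀ v → adj v v ≡ false
    closed : ∀ u v → adj u v ≡ true → u ∈ verts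
open Graph public

_∈V_ : ℕ → Graph → Set
v ∈V G = v ∈ verts G

_≅_ : Graph → Graph → Set
G ≅ H = (∀ v → (v ∈V G) ⇔ (v ∈V H)) × (∀ u v → adj G u v ≡ adj H u v)

deg : Graph → ℕ → ℕ
deg G x = length (filterᵇ (adj G x) (verts G))

MaxDeg≤3 : Graph → Set
MaxDeg≤3 G = ∀ v → v ∈V G → deg G v ≤ 3

data Reach (G : Graph) : ℕ → ℕ → Set where
  here : ∀ {v} → v ∈V G → Reach G v v
  step : ∀ {u w v} → adj G u w ≡ true → Reach G w v → Reach G u v

Connected : Graph → Set
Connected G = (verts G ≢ []) × (∀ u v → u ∈V G → v ∈V G → Reach G u v)

Circle : Graph → Set
Circle G = Connected G × (∀ v → v ∈V G → deg G v ≡ 2)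

Disjoint : Graph → Graph → Set
Disjoint G H = ∀ v → v ∈V G → v ∈V H → ⊥

-- IsGlue G H x y R : R is (equal to) G +_{x,y} H, including the side
-- conditions required for the operation to be defined.
IsGlue : Graph → Graph → ℕ → ℕ → Graph → Set
IsGlue G H x y R =
  Disjoint G H × MaxDeg≤3 G × MaxDeg≤3 H ×
  x ∈V G × y ∈V H × deg G x ≡ 2 × deg H y ≡ 2 ×
  (∀ v → (v ∈V R) ⇔ (v ∈V G ⊎ v ∈V H)) ×
  (∀ u v → (adj R u v ≡ true) ⇔
       (adj G u v ≡ true ⊎ adj H u v ≡ true ⊎
        (u ≡ x × v ≡ y) ⊎ (u ≡ y × v ≡ x)))

-- T is a circle-tree determined by the circles (C i : i < k), k = suc n.
-- Ts i plays the role of T(i).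
Determines : (n : ℕ) → (Fin (suc n) → Graph) → Graph → Set
Determines n C T =
  (∀ i → Circle (C i)) ×
  Σ (Fin (suc n) → Graph) λ Ts →
    (Ts zero ≅ C zero) ×
    (∀ (i : Fin n) → ∃ λ x → ∃ λ y →
        IsGlue (Ts (inject₁ i)) (C (suc i)) x y (Ts (suc i))) ×
    (T ≅ Ts (fromℕ n))

-- If C(j) is not the last circle, reorder all circles but the
-- last one (they determine the previous stage) and glue the last circle back on at the end. If C(j)
-- is the last circle L, it is glued at a vertex x of some earlier circle C(p); reorder the others to
-- start with C(p), and then glue L first. This is possible because x has degree 2 in every stage
-- before L is glued, and two gluings commute: (P +_{a,b} Q) +_{x,y} L = (P +_{x,y} L) +_{a,b} Q,
-- where a ≠ x since a has degree 3 once Q is glued while x keeps degree 2 until L is glued.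
module Submission where

open import Defs
open import Data.Bool using (Bool; true)
open import Data.Bool.Properties using (T-≡) renaming (_≟_ to _≟ᵇ_)
open import Data.Empty using (⊥-elim)
open import Data.Fin using (Fin; zero; suc; inject₁; fromℕ)
open import Data.Fin.Relation.Unary.Top using (view; ‵fromℕ; ‵inject₁)
open import Data.List using (List; []; _∷_; length; filterᵇ; _++_)
open import Data.List.Membership.Propositional using (_∈_)
open import Data.List.Membership.Propositional.Properties
  using (∈-∃++; ∈-++⁻; ∈-++⁺ˡ; ∈-++⁺ʳ; ++-∈⇔; ∈-filter⁺; ∈-filter⁻)
open import Data.List.Relation.Binary.Permutation.Propositional.Properties using (↭-length; shift)
open import Data.List.Relation.Binary.Subset.Propositional using (_⊆_)
open import Data.List.Relation.Unary.All as All using ()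
open import Data.List.Relation.Unary.Any using (here; there)
open import Data.List.Relation.Unary.Unique.Propositional using (Unique; _∷_)
open import Data.List.Relation.Unary.Unique.Propositional.Properties using (filter⁺; ++⁺)
open import Data.Nat using (ℕ; zero; suc; _≤_; _≟_; s≤s; z≤n)
open import Data.Nat.Properties using (≤-trans; ≤-antisym; ≤-reflexive; module ≤-Reasoning)
open import Data.Product using (Σ; _×_; _,_; ∃; ∃₂; proj₁; proj₂)
open import Data.Sum using (_⊎_; inj₁; inj₂; [_,_]; swap)
open import Data.Sum.Function.Propositional using (_⊎-⇔_)
open import Data.Vec.Functional using (Vector; head; tail; init; last) renaming (_∷_ to _∷ᵥ_)
open import Function using (_∘_)
open import Function.Bundles using (_⇔_; mk⇔; Equivalence)
open import Function.Properties.Equivalence using () renaming (refl to ⇔-refl; trans to ⇔-trans)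
open import Relation.Binary.PropositionalEquality
  using (_≡_; _≢_; _≗_; refl; sym; trans; cong; subst; module ≡-Reasoning)
open import Relation.Nullary using (¬_; Dec; yes; no; does)
open import Relation.Nullary.Decidable using (T?; _⊎-dec_; _×-dec_; dec-false; does-⇔)

open Equivalence using (to; from)

private
  variable
    A : Set
    n : ℕ
    x y a b u v w : ℕ
    G H L P Q R G′ R′ P₁ T T′ : Graph
    C C′ : Vector Graph (suc n)

Unique-⊆⇒length≤ : {xs ys : List A} → Unique xs → xs ⊆ ys → length xs ≤ length ys
Unique-⊆⇒length≤ {xs = []} _ _ = z≤n
Unique-⊆⇒length≤ {xs = z ∷ xs} (z∉xs ∷ xs!) xs⊆ys with ∈-∃++ (xs⊆ys (here refl))
... | ys₁ , ys₂ , refl = begin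
  suc (length xs)           ≤⟨ s≤s (Unique-⊆⇒length≤ xs! xs⊆ys₁++ys₂) ⟩
  suc (length (ys₁ ++ ys₂)) ≡⟨ ↭-length (shift z ys₁ ys₂) ⟨
  length (ys₁ ++ z ∷ ys₂)   ∎
  where
  open ≤-Reasoning
  xs⊆ys₁++ys₂ : xs ⊆ ys₁ ++ ys₂
  xs⊆ys₁++ys₂ w∈xs with ∈-++⁻ ys₁ (xs⊆ys (there w∈xs))
  ... | inj₁ w∈ys₁         = ∈-++⁺ˡ w∈ys₁
  ... | inj₂ (here refl)   = ⊥-elim (All.lookup z∉xs w∈xs refl)
  ... | inj₂ (there w∈ys₂) = ∈-++⁺ʳ ys₁ w∈ys₂

infixl 5 _∷ʳ_

_∷ʳ_ : Vector A n → A → Vector A (suc n)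
_∷ʳ_ {n = zero}  xs z zero    = z
_∷ʳ_ {n = suc n} xs z zero    = head xs
_∷ʳ_ {n = suc n} xs z (suc i) = (tail xs ∷ʳ z) i

∷ʳ-inject₁ : (xs : Vector A n) (z : A) (i : Fin n) → (xs ∷ʳ z) (inject₁ i) ≡ xs i
∷ʳ-inject₁ xs z zero    = refl
∷ʳ-inject₁ xs z (suc i) = ∷ʳ-inject₁ (tail xs) z i

∷ʳ-fromℕ : (xs : Vector A n) (z : A) → (xs ∷ʳ z) (fromℕ n) ≡ z
∷ʳ-fromℕ {n = zero}  xs z = refl
∷ʳ-fromℕ {n = suc n} xs z = ∷ʳ-fromℕ (tail xs) z

init-∷ʳ-last : (xs : Vector A (suc n)) → init xs ∷ʳ last xs ≗ xs
init-∷ʳ-last {n = zero}  xs zero    = refl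
init-∷ʳ-last {n = suc n} xs zero    = refl
init-∷ʳ-last {n = suc n} xs (suc i) = init-∷ʳ-last (tail xs) i

∷-init-∷ʳ-last : (z : A) (xs : Vector A (suc n)) → (z ∷ᵥ init xs) ∷ʳ last xs ≗ z ∷ᵥ xs
∷-init-∷ʳ-last z xs zero    = refl
∷-init-∷ʳ-last z xs (suc i) = init-∷ʳ-last xs i

⊎-exchange : {X Y A B C : Set} → X ⇔ (A ⊎ B) → Y ⇔ (A ⊎ C) → (X ⊎ C) ⇔ (Y ⊎ B)
⊎-exchange {X} {Y} {A} {B} {C} X⇔A⊎B Y⇔A⊎C = mk⇔ forth back
  where
  forth : X ⊎ C → Y ⊎ B
  forth (inj₁ p) = [ inj₁ ∘ from Y⇔A⊎C ∘ inj₁ , inj₂ ] (to X⇔A⊎B p)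
  forth (inj₂ p) = inj₁ (from Y⇔A⊎C (inj₂ p))
  back : Y ⊎ B → X ⊎ C
  back (inj₁ q) = [ inj₁ ∘ from X⇔A⊎B ∘ inj₁ , inj₂ ] (to Y⇔A⊎C q)
  back (inj₂ q) = inj₁ (from X⇔A⊎B (inj₂ q))

does≡true⇔ : (a? : Dec A) → does a? ≡ true ⇔ A
does≡true⇔ (yes a) = mk⇔ (λ _ → a) (λ _ → refl)
does≡true⇔ (no ¬a) = mk⇔ (λ ()) (⊥-elim ∘ ¬a)

≡true-cong : {p q : Bool} → p ≡ q → p ≡ true ⇔ q ≡ true
≡true-cong p≡q = mk⇔ (trans (sym p≡q)) (trans p≡q)

≅-refl : G ≅ G
≅-refl = (λ _ → ⇔-refl) , (λ _ _ → refl)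

≅-trans : G ≅ H → H ≅ L → G ≅ L
≅-trans (G≈H , adj≡) (H≈L , adj≡′) =
  (λ v → ⇔-trans (G≈H v) (H≈L v)) , (λ u v → trans (adj≡ u v) (adj≡′ u v))

record _⊑_ (G H : Graph) : Set where
  field
    vert : v ∈V G → v ∈V H
    edge : adj G u v ≡ true → adj H u v ≡ true
open _⊑_

⊑-trans : G ⊑ H → H ⊑ L → G ⊑ L
⊑-trans G⊑H H⊑L = record { vert = vert H⊑L ∘ vert G⊑H ; edge = edge H⊑L ∘ edge G⊑H }

≅⇒⊑ : G ≅ H → G ⊑ H
≅⇒⊑ (G≈H , adj≡) = record { vert = to (G≈H _) ; edge = trans (sym (adj≡ _ _)) }

≅⇒⊒ : G ≅ H → H ⊑ G
≅⇒⊒ (G≈H , adj≡) = record { vert = from (G≈H _) ; edge = trans (adj≡ _ _) }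

neighbours : Graph → ℕ → List ℕ
neighbours G v = filterᵇ (adj G v) (verts G)

neighbours-unique : ∀ G v → Unique (neighbours G v)
neighbours-unique G v = filter⁺ (T? ∘ adj G v) (uniq G)

adj⇒∈Vʳ : ∀ G → adj G u v ≡ true → v ∈V G
adj⇒∈Vʳ G uv = closed G _ _ (trans (adjSym G _ _) uv)

∈-neighbours : ∀ G v → w ∈ neighbours G v ⇔ adj G v w ≡ true
∈-neighbours G v = mk⇔
  (to T-≡ ∘ proj₂ ∘ ∈-filter⁻ (T? ∘ adj G v) {xs = verts G})
  (λ vw → ∈-filter⁺ (T? ∘ adj G v) (adj⇒∈Vʳ G vw) (from T-≡ vw))

deg≤length : ∀ G v {ws} → (∀ {w} → adj G v w ≡ true → w ∈ ws) → deg G v ≤ length ws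
deg≤length G v ⊆ws = Unique-⊆⇒length≤ (neighbours-unique G v) (⊆ws ∘ to (∈-neighbours G v))

length≤deg : ∀ G v {ws} → Unique ws → (∀ {w} → w ∈ ws → adj G v w ≡ true) → length ws ≤ deg G v
length≤deg G v ws! ws⊆ = Unique-⊆⇒length≤ ws! (from (∈-neighbours G v) ∘ ws⊆)

deg-mono-⊑ : G ⊑ H → ∀ v → deg G v ≤ deg H v
deg-mono-⊑ {G} {H} G⊑H v = length≤deg H v (neighbours-unique G v) (edge G⊑H ∘ to (∈-neighbours G v))

MaxDeg≤3-⊑ : G ⊑ H → MaxDeg≤3 H → MaxDeg≤3 G
MaxDeg≤3-⊑ G⊑H maxH v v∈G = ≤-trans (deg-mono-⊑ G⊑H v) (maxH v (vert G⊑H v∈G))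

Circle-⊑-deg : Circle H → H ⊑ G → v ∈V H → 2 ≤ deg G v
Circle-⊑-deg (_ , deg≡2) H⊑G v∈H = ≤-trans (≤-reflexive (sym (deg≡2 _ v∈H))) (deg-mono-⊑ H⊑G _)

SameEdge : ℕ → ℕ → ℕ → ℕ → Set
SameEdge x y u v = (u ≡ x × v ≡ y) ⊎ (u ≡ y × v ≡ x)

GlueEdge : Graph → Graph → ℕ → ℕ → ℕ → ℕ → Set
GlueEdge G H x y u v = adj G u v ≡ true ⊎ adj H u v ≡ true ⊎ SameEdge x y u v

record GlueShape (G H : Graph) (x y : ℕ) (R : Graph) : Set where
  constructor mkShape
  field
    vertices : ∀ v → v ∈V R ⇔ (v ∈V G ⊎ v ∈V H)
    edges    : ∀ u v → adj R u v ≡ true ⇔ GlueEdge G H x y u v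

  ⊑ˡ : G ⊑ R
  ⊑ˡ = record { vert = from (vertices _) ∘ inj₁ ; edge = from (edges _ _) ∘ inj₁ }

  ⊑ʳ : H ⊑ R
  ⊑ʳ = record { vert = from (vertices _) ∘ inj₂ ; edge = from (edges _ _) ∘ inj₂ ∘ inj₁ }
open GlueShape

GlueShape-swap : GlueShape G H x y R → GlueShape H G y x R
GlueShape-swap s = mkShape
  (λ v → ⇔-trans (vertices s v) (mk⇔ swap swap))
  (λ u v → ⇔-trans (edges s u v) (mk⇔ flip flip))
  where
  flip : {A B C D : Set} → A ⊎ B ⊎ C ⊎ D → B ⊎ A ⊎ D ⊎ C
  flip (inj₁ p)               = inj₂ (inj₁ p)
  flip (inj₂ (inj₁ p))        = inj₁ p
  flip (inj₂ (inj₂ (inj₁ p))) = inj₂ (inj₂ (inj₂ p))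
  flip (inj₂ (inj₂ (inj₂ p))) = inj₂ (inj₂ (inj₁ p))

GlueShape-respˡ : G ≅ G′ → GlueShape G H x y R → GlueShape G′ H x y R
GlueShape-respˡ (G≈G′ , adj≡) s = mkShape
  (λ v → ⇔-trans (vertices s v) (G≈G′ v ⊎-⇔ ⇔-refl))
  (λ u v → ⇔-trans (edges s u v) (≡true-cong (adj≡ u v) ⊎-⇔ ⇔-refl))

GlueShape-respʳ : R′ ≅ R → GlueShape G H x y R → GlueShape G H x y R′
GlueShape-respʳ (R′≈R , adj≡) s = mkShape
  (λ v → ⇔-trans (R′≈R v) (vertices s v))
  (λ u v → ⇔-trans (≡true-cong (adj≡ u v)) (edges s u v))

GlueShape-exchange : GlueShape P Q a b P₁ → GlueShape P L x y G → GlueShape P₁ L x y R → GlueShape G Q a b R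
GlueShape-exchange s₁ s₂ s₃ = mkShape
  (λ v → ⇔-trans (vertices s₃ v) (⊎-exchange (vertices s₁ v) (vertices s₂ v)))
  (λ u v → ⇔-trans (edges s₃ u v) (⊎-exchange (edges s₁ u v) (edges s₂ u v)))

GlueShape-exists : Disjoint G H → x ∈V G → y ∈V H → ∃ (GlueShape G H x y)
GlueShape-exists {G} {H} {x} {y} G#H x∈G y∈H = glued , mkShape (λ _ → ++-∈⇔) glueEdge⇔
  where
  glueEdge? : ∀ u v → Dec (GlueEdge G H x y u v)
  glueEdge? u v = adj G u v ≟ᵇ true ⊎-dec adj H u v ≟ᵇ true
                  ⊎-dec (u ≟ x ×-dec v ≟ y) ⊎-dec (u ≟ y ×-dec v ≟ x)

  glueEdge⇔ : ∀ u v → does (glueEdge? u v) ≡ true ⇔ GlueEdge G H x y u v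
  glueEdge⇔ u v = does≡true⇔ (glueEdge? u v)

  reverse : GlueEdge G H x y u v → GlueEdge G H x y v u
  reverse (inj₁ uv∈G)                       = inj₁ (trans (adjSym G _ _) uv∈G)
  reverse (inj₂ (inj₁ uv∈H))                = inj₂ (inj₁ (trans (adjSym H _ _) uv∈H))
  reverse (inj₂ (inj₂ (inj₁ (refl , refl)))) = inj₂ (inj₂ (inj₂ (refl , refl)))
  reverse (inj₂ (inj₂ (inj₂ (refl , refl)))) = inj₂ (inj₂ (inj₁ (refl , refl)))

  noLoop : ¬ GlueEdge G H x y v v
  noLoop (inj₁ vv∈G)                       with () ← trans (sym vv∈G) (irrefl G _)
  noLoop (inj₂ (inj₁ vv∈H))                with () ← trans (sym vv∈H) (irrefl H _)
  noLoop (inj₂ (inj₂ (inj₁ (refl , refl)))) = G#H _ x∈G y∈H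
  noLoop (inj₂ (inj₂ (inj₂ (refl , refl)))) = G#H _ x∈G y∈H

  source : GlueEdge G H x y u v → u ∈V G ⊎ u ∈V H
  source (inj₁ uv∈G)                    = inj₁ (closed G _ _ uv∈G)
  source (inj₂ (inj₁ uv∈H))             = inj₂ (closed H _ _ uv∈H)
  source (inj₂ (inj₂ (inj₁ (refl , _)))) = inj₁ x∈G
  source (inj₂ (inj₂ (inj₂ (refl , _)))) = inj₂ y∈H

  glued : Graph
  glued = record
    { verts  = verts G ++ verts H
    ; uniq   = ++⁺ (uniq G) (uniq H) (λ (v∈G , v∈H) → G#H _ v∈G v∈H)
    ; adj    = λ u v → does (glueEdge? u v)
    ; adjSym = λ u v → does-⇔ (mk⇔ reverse reverse) (glueEdge? u v) (glueEdge? v u)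
    ; irrefl = λ v → dec-false (glueEdge? v v) noLoop
    ; closed = λ u v uv → from ++-∈⇔ (source (to (glueEdge⇔ u v) uv))
    }

-- IsGlue and Determines as records: unlike those defined Σ-types, their indices can be inferred
-- by unification.
record Glue (G H : Graph) (x y : ℕ) (R : Graph) : Set where
  field
    disjoint : Disjoint G H
    maxDegˡ  : MaxDeg≤3 G
    maxDegʳ  : MaxDeg≤3 H
    attachˡ  : x ∈V G
    attachʳ  : y ∈V H
    degˡ     : deg G x ≡ 2
    degʳ     : deg H y ≡ 2
    shape    : GlueShape G H x y R
open Glue

IsGlue⇒Glue : IsGlue G H x y R → Glue G H x y R
IsGlue⇒Glue (G#H , maxG , maxH , x∈G , y∈H , degx , degy , vs , es) =
  record { disjoint = G#H ; maxDegˡ = maxG ; maxDegʳ = maxH ; attachˡ = x∈G ; attachʳ = y∈H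
         ; degˡ = degx ; degʳ = degy ; shape = mkShape vs es }

Glue⇒IsGlue : Glue G H x y R → IsGlue G H x y R
Glue⇒IsGlue g = disjoint g , maxDegˡ g , maxDegʳ g , attachˡ g , attachʳ g , degˡ g , degʳ g ,
                vertices (shape g) , edges (shape g)

deg-squeeze : G′ ⊑ G → deg G x ≡ 2 → 2 ≤ deg G′ x → deg G′ x ≡ 2
deg-squeeze G′⊑G degx 2≤ = ≤-antisym (≤-trans (deg-mono-⊑ G′⊑G _) (≤-reflexive degx)) 2≤

Glue-swap : Glue G H x y R → Glue H G y x R
Glue-swap g = record
  { disjoint = λ v v∈H v∈G → disjoint g v v∈G v∈H
  ; maxDegˡ  = maxDegʳ g
  ; maxDegʳ  = maxDegˡ g
  ; attachˡ  = attachʳ g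
  ; attachʳ  = attachˡ g
  ; degˡ     = degʳ g
  ; degʳ     = degˡ g
  ; shape    = GlueShape-swap (shape g)
  }

Glue-respˡ : G ≅ G′ → Glue G H x y R → Glue G′ H x y R
Glue-respˡ {G} {G′} G≅G′ g = record
  { disjoint = λ v → disjoint g v ∘ vert G′⊑G
  ; maxDegˡ  = MaxDeg≤3-⊑ G′⊑G (maxDegˡ g)
  ; maxDegʳ  = maxDegʳ g
  ; attachˡ  = vert G⊑G′ (attachˡ g)
  ; attachʳ  = attachʳ g
  ; degˡ     = deg-squeeze G′⊑G (degˡ g) (≤-trans (≤-reflexive (sym (degˡ g))) (deg-mono-⊑ G⊑G′ _))
  ; degʳ     = degʳ g
  ; shape    = GlueShape-respˡ G≅G′ (shape g)
  }
  where
  G⊑G′ : G ⊑ G′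
  G⊑G′ = ≅⇒⊑ G≅G′
  G′⊑G : G′ ⊑ G
  G′⊑G = ≅⇒⊒ G≅G′

Glue-respʳ : R′ ≅ R → Glue G H x y R → Glue G H x y R′
Glue-respʳ R′≅R g = record
  { disjoint = disjoint g
  ; maxDegˡ  = maxDegˡ g
  ; maxDegʳ  = maxDegʳ g
  ; attachˡ  = attachˡ g
  ; attachʳ  = attachʳ g
  ; degˡ     = degˡ g
  ; degʳ     = degʳ g
  ; shape    = GlueShape-respʳ R′≅R (shape g)
  }

Glue-adjˡ : Glue G H x y R → v ∈V G → adj R v w ≡ true → adj G v w ≡ true ⊎ (v ≡ x × w ≡ y)
Glue-adjˡ {H = H} g v∈G vw with to (edges (shape g) _ _) vw
... | inj₁ vw∈G                    = inj₁ vw∈G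
... | inj₂ (inj₁ vw∈H)             = ⊥-elim (disjoint g _ v∈G (closed H _ _ vw∈H))
... | inj₂ (inj₂ (inj₁ xy))        = inj₂ xy
... | inj₂ (inj₂ (inj₂ (refl , _))) = ⊥-elim (disjoint g _ v∈G (attachʳ g))

Glue-deg-attach : Glue G H x y R → deg R x ≡ 3
Glue-deg-attach {G} {H} {x} {y} {R} g = begin
  deg R x                     ≡⟨ ≤-antisym upper lower ⟩
  length (y ∷ neighbours G x) ≡⟨ cong suc (degˡ g) ⟩
  3                           ∎
  where
  open ≡-Reasoning
  upper : deg R x ≤ length (y ∷ neighbours G x)
  upper = deg≤length R x λ xw →
    [ there ∘ from (∈-neighbours G x) , here ∘ proj₂ ] (Glue-adjˡ g (attachˡ g) xw)
  y∉ : ∀ {w} → w ∈ neighbours G x → y ≢ w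
  y∉ w∈ refl = disjoint g _ (adj⇒∈Vʳ G (to (∈-neighbours G x) w∈)) (attachʳ g)
  lower : length (y ∷ neighbours G x) ≤ deg R x
  lower = length≤deg R x (All.tabulate y∉ ∷ neighbours-unique G x) λ where
    (here refl) → from (edges (shape g) x y) (inj₂ (inj₂ (inj₁ (refl , refl))))
    (there w∈)  → edge (⊑ˡ (shape g)) (to (∈-neighbours G x) w∈)

Glue-deg-other : Glue G H x y R → v ∈V G → v ≢ x → deg R v ≡ deg G v
Glue-deg-other {G} {R = R} g v∈G v≢x = ≤-antisym
  (deg≤length R _ λ vw → [ from (∈-neighbours G _) , ⊥-elim ∘ v≢x ∘ proj₁ ] (Glue-adjˡ g v∈G vw))
  (deg-mono-⊑ (⊑ˡ (shape g)) _)

Glue-maxDeg : Glue G H x y R → MaxDeg≤3 R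
Glue-maxDeg g v v∈R = [ fromˡ g , fromˡ (Glue-swap g) ] (to (vertices (shape g) v) v∈R)
  where
  fromˡ : ∀ {G H x y R v} → Glue G H x y R → v ∈V G → deg R v ≤ 3
  fromˡ {x = x} {v = v} g v∈G with v ≟ x
  ... | yes refl = ≤-reflexive (Glue-deg-attach g)
  ... | no v≢x   = ≤-trans (≤-reflexive (Glue-deg-other g v∈G v≢x)) (maxDegˡ g _ v∈G)

Glue-restrictˡ : G′ ⊑ G → x ∈V G′ → 2 ≤ deg G′ x → Glue G H x y R → ∃ (Glue G′ H x y)
Glue-restrictˡ {G′ = G′} {x = x} {H = H} {y = y} G′⊑G x∈G′ 2≤deg g = proj₁ glued , record
  { disjoint = G′#H
  ; maxDegˡ  = MaxDeg≤3-⊑ G′⊑G (maxDegˡ g)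
  ; maxDegʳ  = maxDegʳ g
  ; attachˡ  = x∈G′
  ; attachʳ  = attachʳ g
  ; degˡ     = deg-squeeze G′⊑G (degˡ g) 2≤deg
  ; degʳ     = degʳ g
  ; shape    = proj₂ glued
  }
  where
  G′#H : Disjoint G′ H
  G′#H v = disjoint g v ∘ vert G′⊑G
  glued : ∃ (GlueShape G′ H x y)
  glued = GlueShape-exists G′#H x∈G′ (attachʳ g)

Glue-exchange : Glue P Q a b P₁ → Glue P L x y G → Glue P₁ L x y R → Glue G Q a b R
Glue-exchange {Q = Q} {a = a} {x = x} {G = G} g₁ g₂ g₃ = record
  { disjoint = G#Q
  ; maxDegˡ  = Glue-maxDeg g₂
  ; maxDegʳ  = maxDegʳ g₁
  ; attachˡ  = vert (⊑ˡ (shape g₂)) (attachˡ g₁)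
  ; attachʳ  = attachʳ g₁
  ; degˡ     = trans (Glue-deg-other g₂ (attachˡ g₁) a≢x) (degˡ g₁)
  ; degʳ     = degʳ g₁
  ; shape    = GlueShape-exchange (shape g₁) (shape g₂) (shape g₃)
  }
  where
  -- a has degree 3 in P₁, but x has degree 2 there.
  a≢x : a ≢ x
  a≢x refl with () ← trans (sym (Glue-deg-attach g₁)) (degˡ g₃)
  G#Q : Disjoint G Q
  G#Q v v∈G v∈Q with to (vertices (shape g₂) v) v∈G
  ... | inj₁ v∈P = disjoint g₁ v v∈P v∈Q
  ... | inj₂ v∈L = disjoint g₃ v (vert (⊑ʳ (shape g₁)) v∈Q) v∈L

Glue-cong : G ≡ G′ → H ≡ L → R ≡ R′ → Glue G H x y R → Glue G′ L x y R′
Glue-cong refl refl refl g = g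

record CircleTree (n : ℕ) (C : Vector Graph (suc n)) (T : Graph) : Set where
  field
    circles : ∀ i → Circle (C i)
    stages  : Vector Graph (suc n)
    start   : stages zero ≅ C zero
    steps   : ∀ i → ∃₂ λ x y → Glue (stages (inject₁ i)) (C (suc i)) x y (stages (suc i))
    finish  : T ≅ stages (fromℕ n)
open CircleTree

Determines⇒CircleTree : Determines n C T → CircleTree n C T
Determines⇒CircleTree (circ , Ts , Ts₀≅C₀ , glue , T≅Tsₙ) = record
  { circles = circ
  ; stages  = Ts
  ; start   = Ts₀≅C₀
  ; steps   = λ i → let x , y , g = glue i in x , y , IsGlue⇒Glue g
  ; finish  = T≅Tsₙ
  }

CircleTree⇒Determines : CircleTree n C T → Determines n C T
CircleTree⇒Determines t =
  circles t , stages t , start t , (λ i → let x , y , g = steps t i in x , y , Glue⇒IsGlue g) , finish t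

CircleTree-cong : C ≗ C′ → CircleTree n C T → CircleTree n C′ T
CircleTree-cong C≗C′ t = record
  { circles = λ i → subst Circle (C≗C′ i) (circles t i)
  ; stages  = stages t
  ; start   = subst (stages t zero ≅_) (C≗C′ zero) (start t)
  ; steps   = λ i → let x , y , g = steps t i in x , y , Glue-cong refl (C≗C′ (suc i)) refl g
  ; finish  = finish t
  }

CircleTree-zero⁺ : Circle (C zero) → T ≅ C zero → CircleTree zero C T
CircleTree-zero⁺ {C = C} circ T≅C₀ = record
  { circles = λ { zero → circ }
  ; stages  = λ _ → C zero
  ; start   = ≅-refl {C zero}
  ; steps   = λ ()
  ; finish  = T≅C₀
  }

CircleTree-zero⁻ : CircleTree zero C T → T ≅ C zero
CircleTree-zero⁻ {C = C} {T = T} t = ≅-trans {T} {stages t zero} {C zero} (finish t) (start t)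

CircleTree-∷ʳ⁺ : CircleTree n C T′ → Circle L → Glue T′ L x y T → CircleTree (suc n) (C ∷ʳ L) T
CircleTree-∷ʳ⁺ {n} {C} {L = L} {T = T} t circL g = record
  { circles = circles′
  ; stages  = stages t ∷ʳ T
  ; start   = start t
  ; steps   = steps′
  ; finish  = subst (T ≅_) (sym (∷ʳ-fromℕ (stages t) T)) (≅-refl {T})
  }
  where
  circles′ : ∀ i → Circle ((C ∷ʳ L) i)
  circles′ i with view i
  ... | ‵fromℕ     = subst Circle (sym (∷ʳ-fromℕ C L)) circL
  ... | ‵inject₁ j = subst Circle (sym (∷ʳ-inject₁ C L j)) (circles t j)
  steps′ : ∀ i → ∃₂ λ x y →
           Glue ((stages t ∷ʳ T) (inject₁ i)) ((C ∷ʳ L) (suc i)) x y ((stages t ∷ʳ T) (suc i))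
  steps′ i with view i
  ... | ‵fromℕ = _ , _ ,
    Glue-cong (sym (∷ʳ-inject₁ (stages t) T (fromℕ n))) (sym (∷ʳ-fromℕ C L)) (sym (∷ʳ-fromℕ (stages t) T))
              (Glue-respˡ (finish t) g)
  ... | ‵inject₁ j = let a , b , h = steps t j in a , b ,
    Glue-cong (sym (∷ʳ-inject₁ (stages t) T (inject₁ j))) (sym (∷ʳ-inject₁ C L (suc j)))
              (sym (∷ʳ-inject₁ (stages t) T (suc j))) h

CircleTree-∷ʳ⁻ : CircleTree (suc n) C T → ∃ λ T′ → CircleTree n (init C) T′ × ∃₂ λ x y → Glue T′ (last C) x y T
CircleTree-∷ʳ⁻ {n} {C} t =
  let x , y , g = steps t (fromℕ n) in
  stages t (inject₁ (fromℕ n)) , prefix , x , y , Glue-respʳ (finish t) g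
  where
  prefix : CircleTree n (init C) (stages t (inject₁ (fromℕ n)))
  prefix = record
    { circles = circles t ∘ inject₁
    ; stages  = init (stages t)
    ; start   = start t
    ; steps   = steps t ∘ inject₁
    ; finish  = ≅-refl {stages t (inject₁ (fromℕ n))}
    }

CircleTree-head⊑ : CircleTree n C T → C zero ⊑ T
CircleTree-head⊑ {zero}  t = ≅⇒⊒ (CircleTree-zero⁻ t)
CircleTree-head⊑ {suc n} t with CircleTree-∷ʳ⁻ t
... | _ , t′ , _ , _ , g = ⊑-trans (CircleTree-head⊑ t′) (⊑ˡ (shape g))

CircleTree-∈V : CircleTree n C T → v ∈V T → ∃ λ i → v ∈V C i
CircleTree-∈V {zero}  t v∈T = zero , to (proj₁ (CircleTree-zero⁻ t) _) v∈T
CircleTree-∈V {suc n} t v∈T with CircleTree-∷ʳ⁻ t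
... | _ , t′ , _ , _ , g with to (vertices (shape g) _) v∈T
...   | inj₁ v∈T′ = let i , v∈Cᵢ = CircleTree-∈V t′ v∈T′ in inject₁ i , v∈Cᵢ
...   | inj₂ v∈L  = fromℕ (suc n) , v∈L

CircleTree-∷ : CircleTree n C T′ → Circle L → x ∈V C zero → Glue T′ L x y T → CircleTree (suc n) (L ∷ᵥ C) T
CircleTree-∷ {zero} {C} {L = L} t circL _ g =
  CircleTree-cong (∷-init-∷ʳ-last L C)
    (CircleTree-∷ʳ⁺ (CircleTree-zero⁺ {C = L ∷ᵥ init C} circL (≅-refl {L})) (circles t zero)
                    (Glue-swap (Glue-respˡ (CircleTree-zero⁻ t) g)))
CircleTree-∷ {suc n} {C} {L = L} {x = x} {y = y} t circL x∈C₀ g with CircleTree-∷ʳ⁻ t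
... | T₁ , t₁ , _ , _ , h =
  CircleTree-cong (∷-init-∷ʳ-last L C)
    (CircleTree-∷ʳ⁺ (CircleTree-∷ t₁ circL x∈C₀ (proj₂ g₁)) (circles t (fromℕ (suc n)))
                    (Glue-exchange h (proj₂ g₁) g))
  where
  C₀⊑T₁ : C zero ⊑ T₁
  C₀⊑T₁ = CircleTree-head⊑ t₁
  g₁ : ∃ (Glue T₁ L x y)
  g₁ = Glue-restrictˡ (⊑ˡ (shape h)) (vert C₀⊑T₁ x∈C₀) (Circle-⊑-deg (circles t zero) C₀⊑T₁ x∈C₀) g

CircleTree-toFront : CircleTree n C T → ∀ j → ∃ λ C′ → CircleTree n C′ T × C′ zero ≅ C j
CircleTree-toFront {zero} {C} t zero = C , t , ≅-refl {C zero}
CircleTree-toFront {suc n} {C} t j with CircleTree-∷ʳ⁻ t | view j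
... | _ , t′ , _ , _ , g | ‵inject₁ i =
  let C′ , t″ , C′₀≅Cᵢ = CircleTree-toFront t′ i in
  C′ ∷ʳ last C , CircleTree-∷ʳ⁺ t″ (circles t (fromℕ (suc n))) g , C′₀≅Cᵢ
... | _ , t′ , _ , _ , g | ‵fromℕ =
  let i , x∈Cᵢ         = CircleTree-∈V t′ (attachˡ g)
      C′ , t″ , C′₀≅Cᵢ = CircleTree-toFront t′ i in
  last C ∷ᵥ C′ , CircleTree-∷ t″ (circles t (fromℕ (suc n))) (from (proj₁ C′₀≅Cᵢ _) x∈Cᵢ) g , ≅-refl {last C}

lemma4p10 : (n : ℕ) (C : Fin (suc n) → Graph) (T : Graph) →
              Determines n C T →
              (j : Fin (suc n)) →
              Σ (Fin (suc n) → Graph) λ C′ → Determines n C′ T × (C′ zero ≅ C j)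
lemma4p10 n C T D j =
  let C′ , t , C′₀≅Cⱼ = CircleTree-toFront (Determines⇒CircleTree {n} {C} {T} D) j in
  C′ , CircleTree⇒Determines t , C′₀≅Cⱼ
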